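{- Let $k$ be an odd positive integer and let $F_k:\mathbb{N}\to\mathbb{N}$ be given by $F_k(n)=\frac{3n+k}{2}$ if $n$ is odd and $F_k(n)=\frac{n}{2}$ if $n$ is even. Let $u_1,d_1,\dots,u_s,d_s$ be positive integers, $U=\sum u_i$, $D=\sum d_i$, $\beta=2^{U+D}-3^U$, and for a sequence $(v_1,e_1,\dots,v_s,e_s)$ of positive integers put $$\alpha(v_1,e_1,\dots,v_s,e_s)=\sum_{i=1}^{s} 2^{\sum_{j=1}^{i-1}(v_j+e_j)}\,(3^{v_i}-2^{v_i})\,3^{\sum_{j=i+1}^{s}v_j}.$$ Let $\alpha=\alpha(u_1,d_1,\dots,u_s,d_s)$ and $\alpha'=\alpha(u_2,d_2,\dots,u_s,d_s,u_1,d_1)$. Suppose $T_0=k\alpha/\beta$ is an element of a cycle of $F_k$ whose trajectory from $T_0$ follows the orb sequence $(u_1,d_1,\dots,u_s,d_s)$ and returns to $T_0$. Then the element of the cycle one orb after $T_0$ is $$F_k^{u_1+d_1}(T_0)=\frac{k\alpha'}{\beta}.$$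
   Context: The trajectory of $T_0$ follows the orb sequence $(u_1,d_1,\dots,u_s,d_s)$ if, with $x_0=T_0$, $x_{t+1}=F_k(x_t)$, among $x_0,\dots,x_{U+D-1}$ the first $u_1$ are odd, the next $d_1$ even, the next $u_2$ odd, etc., ending with $d_s$ even values. -}

module Defs where

open import Data.Nat using (ℕ; zero; suc; _+_; _*_; _∸_; _^_; _%_; _/_; _≡ᵇ_)
open import Data.Bool using (Bool; true; false; if_then_else_)
open import Data.Fin using (Fin; toℕ)
open import Data.List using (List; []; _∷_; map; take; drop; length; allFin; lookup; replicate; _++_; concatMap)
open import Data.Product using (_×_; _,_; proj₁; proj₂)
open import Data.Nat.ListAction using (sum)
open import Data.Unit using (⊤)
open import Relation.Binary.PropositionalEquality using (_≡_)

isOdd : ℕ → Bool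
isOdd n = n % 2 ≡ᵇ 1

F : ℕ → ℕ → ℕ
F k n = if isOdd n then (3 * n + k) / 2 else n / 2

iter : (ℕ → ℕ) → ℕ → ℕ → ℕ
iter f zero    x = x
iter f (suc m) x = f (iter f m x)

Orbs : Set
Orbs = List (ℕ × ℕ)

U : Orbs → ℕ
U os = sum (map proj₁ os)

D : Orbs → ℕ
D os = sum (map proj₂ os)

-- α(v_1,e_1,...,v_s,e_s) = Σ_{i=1}^s 2^{Σ_{j<i}(v_j+e_j)} (3^{v_i} - 2^{v_i}) 3^{Σ_{j>i} v_j}
-- (index i here is 0-based; 3^v - 2^v ≥ 0 so truncated subtraction is exact)
α : Orbs → ℕ
α os = sum (map term (allFin (length os)))
  where
  term : Fin (length os) → ℕ
  term i = 2 ^ sum (map (λ p → proj₁ p + proj₂ p) (take (toℕ i) os))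
         * (3 ^ proj₁ (lookup os i) ∸ 2 ^ proj₁ (lookup os i))
         * 3 ^ sum (map proj₁ (drop (suc (toℕ i)) os))

pattern' : Orbs → List Bool
pattern' = concatMap (λ p → replicate (proj₁ p) true ++ replicate (proj₂ p) false)

followsPattern : (ℕ → ℕ) → ℕ → List Bool → Set
followsPattern f x []       = ⊤
followsPattern f x (b ∷ bs) = (isOdd x ≡ b) × followsPattern f (f x) bs

Follows : ℕ → ℕ → Orbs → Set
Follows k T0 os = followsPattern (F k) T0 (pattern' os)

module Submission where

-- Write the first orb as (u , d) and put
--   a = 2^(u+d),  t = 3^u,  γ u = 3^u - 2^u,  T₁ = F_k^(u+d)(T₀).
-- (1) One orb of the trajectory is an affine map: along u odd steps
--     2^u (y + k) = 3^u (T₀ + k), and along d even steps 2^d T₁ = y, hence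
--         a · T₁ = t · T₀ + γ u · k.                             (orb-step)
-- (2) The weight α satisfies two recursions, peeling off the first orb
--     or appending an orb at the end:
--         α ((u , d) ∷ rest)   = γ u · 3^U(rest) + a · α rest        (α-cons)
--         α (rest ++ [(u , d)]) = t · α rest + γ u · 2^(U+D)(rest)   (α-snoc)
-- (3) With β = a · 2^(U+D)(rest) - t · 3^U(rest), the relation T₀ β = k α
--     and (1) give a · T₁ β = a · k α' by ring arithmetic over ℤ; cancelling
--     the nonzero factor a yields T₁ β = k α'.                   (cycle-shift)
-- The file proves (1), (2), (3) in this order; theorem9 combines them after
-- casting the natural-number identities into ℤ.

open import Defs
open import Data.Nat using (ℕ; _+_; _*_; _^_; _%_; _≤_)
open import Data.Integer using (ℤ; +_; _-_) renaming (_*_ to _*ℤ_)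
open import Data.List using (List; _∷_; []; _++_)
open import Data.List.Relation.Unary.All using (All)
open import Data.Product using (_×_; _,_; proj₁; proj₂)
open import Relation.Binary.PropositionalEquality using (_≡_)

open import Data.Nat using (zero; suc; s≤s; z≤n; _/_; _∸_)
open import Data.Nat.Properties using (≡ᵇ⇒≡; *-distribˡ-+; ^-distribˡ-+-*; ^-monoˡ-≤; m∸n+n≡m; m^n≢0; +-identityʳ; *-zeroʳ; +-assoc; +-cancelʳ-≡)
open import Data.Nat.DivMod using (%-distribˡ-+; %-distribˡ-*; m%n<n; m*[n/m]≡n)
open import Data.Nat.Divisibility using (m%n≡0⇒n∣m)
open import Data.Nat.ListAction using (sum)
open import Data.Nat.Tactic.RingSolver as ℕ-Ring using ()
open import Data.Integer using (NonZero) renaming (_+_ to _+ℤ_)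
open import Data.Integer.Properties using (pos-+; pos-*; *-cancelˡ-≡)
open import Data.Integer.Tactic.RingSolver as ℤ-Ring using ()
open import Data.Bool using (true; false; T)
open import Data.Fin using (Fin; toℕ) renaming (suc to fsuc)
open import Data.List using (replicate; map; tabulate; length; take; drop; lookup)
open import Data.List.Properties using (++-assoc; map-tabulate; tabulate-cong)
open import Relation.Binary.PropositionalEquality using (refl; sym; trans; cong; cong₂; subst; module ≡-Reasoning)

open ≡-Reasoning

-- (1) One orb of F_k is an affine map

odd-% : ∀ x → isOdd x ≡ true → x % 2 ≡ 1
odd-% x hx = ≡ᵇ⇒≡ (x % 2) 1 (subst T (sym hx) _)

even-% : ∀ x → isOdd x ≡ false → x % 2 ≡ 0
even-% x hx with x % 2 | m%n<n x 2
... | 0 | _ = refl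
... | 1 | _ with hx
...   | ()
even-% x hx | suc (suc _) | s≤s (s≤s ())

double-half : ∀ n → n % 2 ≡ 0 → 2 * (n / 2) ≡ n
double-half n h = m*[n/m]≡n (m%n≡0⇒n∣m n 2 h)

odd-step : ∀ k x → k % 2 ≡ 1 → isOdd x ≡ true → 2 * F k x ≡ 3 * x + k
odd-step k x hk hx rewrite hx = double-half (3 * x + k) (begin
  (3 * x + k) % 2                ≡⟨ %-distribˡ-+ (3 * x) k 2 ⟩
  ((3 * x) % 2 + k % 2) % 2      ≡⟨ cong (λ r → ((3 * x) % 2 + r) % 2) hk ⟩
  ((3 * x) % 2 + 1) % 2          ≡⟨ cong (λ r → (r + 1) % 2) (%-distribˡ-* 3 x 2) ⟩
  ((1 * (x % 2)) % 2 + 1) % 2    ≡⟨ cong (λ r → ((1 * r) % 2 + 1) % 2) (odd-% x hx) ⟩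
  0                              ∎)

even-step : ∀ k x → isOdd x ≡ false → 2 * F k x ≡ x
even-step k x hx rewrite hx = double-half x (even-% x hx)

iter-suc : ∀ (f : ℕ → ℕ) n x → iter f (suc n) x ≡ iter f n (f x)
iter-suc f zero    x = refl
iter-suc f (suc n) x = cong f (iter-suc f n x)

iter-+ : ∀ (f : ℕ → ℕ) m n x → iter f (m + n) x ≡ iter f n (iter f m x)
iter-+ f zero    n x = refl
iter-+ f (suc m) n x = begin
  iter f (suc (m + n)) x       ≡⟨ iter-suc f (m + n) x ⟩
  iter f (m + n) (f x)         ≡⟨ iter-+ f m n (f x) ⟩
  iter f n (iter f m (f x))    ≡⟨ cong (iter f n) (iter-suc f m x) ⟨
  iter f n (iter f (suc m) x)  ∎

follows-after : ∀ f x n b cs → followsPattern f x (replicate n b ++ cs) →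
  followsPattern f (iter f n x) cs
follows-after f x zero    b cs h       = h
follows-after f x (suc n) b cs (_ , h) =
  subst (λ y → followsPattern f y cs) (sym (iter-suc f n x)) (follows-after f (f x) n b cs h)

odd-run : ∀ k → k % 2 ≡ 1 → ∀ n x cs → followsPattern (F k) x (replicate n true ++ cs) →
  2 ^ n * (iter (F k) n x + k) ≡ 3 ^ n * (x + k)
odd-run k hk zero    x cs h        = refl
odd-run k hk (suc n) x cs (hx , h) = begin
  2 * 2 ^ n * (iter (F k) (suc n) x + k)   ≡⟨ cong (λ y → 2 * 2 ^ n * (y + k)) (iter-suc (F k) n x) ⟩
  2 * 2 ^ n * (iter (F k) n (F k x) + k)   ≡⟨ regroup (2 ^ n) _ k ⟩
  2 * (2 ^ n * (iter (F k) n (F k x) + k)) ≡⟨ cong (2 *_) (odd-run k hk n (F k x) cs h) ⟩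
  2 * (3 ^ n * (F k x + k))                ≡⟨ expand (3 ^ n) (F k x) k ⟩
  3 ^ n * (2 * F k x + 2 * k)              ≡⟨ cong (λ y → 3 ^ n * (y + 2 * k)) (odd-step k x hk hx) ⟩
  3 ^ n * (3 * x + k + 2 * k)              ≡⟨ collect (3 ^ n) x k ⟩
  3 * 3 ^ n * (x + k)                      ∎
  where
  regroup : ∀ p y k → 2 * p * (y + k) ≡ 2 * (p * (y + k))
  regroup = ℕ-Ring.solve-∀
  expand : ∀ p y k → 2 * (p * (y + k)) ≡ p * (2 * y + 2 * k)
  expand = ℕ-Ring.solve-∀
  collect : ∀ p x k → p * (3 * x + k + 2 * k) ≡ 3 * p * (x + k)
  collect = ℕ-Ring.solve-∀

even-run : ∀ k n x cs → followsPattern (F k) x (replicate n false ++ cs) →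
  2 ^ n * iter (F k) n x ≡ x
even-run k zero    x cs h        = +-identityʳ x
even-run k (suc n) x cs (hx , h) = begin
  2 * 2 ^ n * iter (F k) (suc n) x    ≡⟨ cong (2 * 2 ^ n *_) (iter-suc (F k) n x) ⟩
  2 * 2 ^ n * iter (F k) n (F k x)    ≡⟨ regroup (2 ^ n) _ ⟩
  2 * (2 ^ n * iter (F k) n (F k x))  ≡⟨ cong (2 *_) (even-run k n (F k x) cs h) ⟩
  2 * F k x                           ≡⟨ even-step k x hx ⟩
  x                                   ∎
  where
  regroup : ∀ p y → 2 * p * y ≡ 2 * (p * y)
  regroup = ℕ-Ring.solve-∀

-- The coefficient 3^v - 2^v of the paper (exact, since 2^v ≤ 3^v).
γ : ℕ → ℕ
γ v = 3 ^ v ∸ 2 ^ v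


γ+2^ : ∀ v → γ v + 2 ^ v ≡ 3 ^ v
γ+2^ v = m∸n+n≡m (^-monoˡ-≤ v (s≤s (s≤s z≤n)))

orb-step : ∀ k → k % 2 ≡ 1 → ∀ u d x cs →
  followsPattern (F k) x ((replicate u true ++ replicate d false) ++ cs) →
  2 ^ (u + d) * iter (F k) (u + d) x ≡ 3 ^ u * x + γ u * k
orb-step k hk u d x cs h = +-cancelʳ-≡ (2 ^ u * k) _ _ (begin
  2 ^ (u + d) * iter (F k) (u + d) x + 2 ^ u * k   ≡⟨ cong₂ (λ p z → p * z + 2 ^ u * k) (^-distribˡ-+-* 2 u d) (iter-+ (F k) u d x) ⟩
  2 ^ u * 2 ^ d * T₁ + 2 ^ u * k                   ≡⟨ factor (2 ^ u) (2 ^ d) T₁ k ⟩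
  2 ^ u * (2 ^ d * T₁ + k)                         ≡⟨ cong (λ z → 2 ^ u * (z + k)) evens ⟩
  2 ^ u * (y + k)                                  ≡⟨ odd-run k hk u x _ h′ ⟩
  3 ^ u * (x + k)                                  ≡⟨ cong (λ c → c * (x + k)) (γ+2^ u) ⟨
  (γ u + 2 ^ u) * (x + k)                          ≡⟨ spread (γ u) (2 ^ u) x k ⟩
  (γ u + 2 ^ u) * x + γ u * k + 2 ^ u * k          ≡⟨ cong (λ c → c * x + γ u * k + 2 ^ u * k) (γ+2^ u) ⟩
  3 ^ u * x + γ u * k + 2 ^ u * k                  ∎)
  where
  h′ : followsPattern (F k) x (replicate u true ++ (replicate d false ++ cs))
  h′ = subst (followsPattern (F k) x) (++-assoc (replicate u true) (replicate d false) cs) h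
  y  = iter (F k) u x
  T₁ = iter (F k) d y
  evens : 2 ^ d * T₁ ≡ y
  evens = even-run k d y cs (follows-after (F k) x u true _ h′)
  factor : ∀ p q z k → p * q * z + p * k ≡ p * (q * z + k)
  factor = ℕ-Ring.solve-∀
  spread : ∀ g p x k → (g + p) * (x + k) ≡ (g + p) * x + g * k + p * k
  spread = ℕ-Ring.solve-∀

-- (2) Recursions for the weight α

α-term : (os : Orbs) → Fin (length os) → ℕ
α-term os i = 2 ^ sum (map (λ p → proj₁ p + proj₂ p) (take (toℕ i) os))
            * (3 ^ proj₁ (lookup os i) ∸ 2 ^ proj₁ (lookup os i))
            * 3 ^ sum (map proj₁ (drop (suc (toℕ i)) os))

α-as-sum : ∀ os → α os ≡ sum (tabulate (α-term os))
α-as-sum os = cong sum (map-tabulate (λ i → i) (α-term os))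

sum-scale : ∀ c xs → sum (map (c *_) xs) ≡ c * sum xs
sum-scale c []       = sym (*-zeroʳ c)
sum-scale c (x ∷ xs) = trans (cong (λ r → c * x + r) (sum-scale c xs)) (sym (*-distribˡ-+ c x (sum xs)))

α-term-suc : ∀ v e os (i : Fin (length os)) →
  α-term ((v , e) ∷ os) (fsuc i) ≡ 2 ^ (v + e) * α-term os i
α-term-suc v e os i = begin
  2 ^ (v + e + s) * g * r     ≡⟨ cong (λ p → p * g * r) (^-distribˡ-+-* 2 (v + e) s) ⟩
  2 ^ (v + e) * 2 ^ s * g * r ≡⟨ regroup (2 ^ (v + e)) (2 ^ s) g r ⟩
  2 ^ (v + e) * (2 ^ s * g * r) ∎
  where
  s = sum (map (λ p → proj₁ p + proj₂ p) (take (toℕ i) os))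
  g = 3 ^ proj₁ (lookup os i) ∸ 2 ^ proj₁ (lookup os i)
  r = 3 ^ sum (map proj₁ (drop (suc (toℕ i)) os))
  regroup : ∀ a b c d → a * b * c * d ≡ a * (b * c * d)
  regroup = ℕ-Ring.solve-∀

α-cons : ∀ v e os → α ((v , e) ∷ os) ≡ γ v * 3 ^ U os + 2 ^ (v + e) * α os
α-cons v e os = begin
  α ((v , e) ∷ os)                                                ≡⟨ α-as-sum ((v , e) ∷ os) ⟩
  1 * γ v * 3 ^ U os + sum (tabulate (λ i → α-term ((v , e) ∷ os) (fsuc i))) ≡⟨ cong₂ _+_ (cong (_* 3 ^ U os) (+-identityʳ (γ v))) later ⟩
  γ v * 3 ^ U os + 2 ^ (v + e) * α os                             ∎
  where
  later : sum (tabulate (λ i → α-term ((v , e) ∷ os) (fsuc i))) ≡ 2 ^ (v + e) * α os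
  later = begin
    sum (tabulate (λ i → α-term ((v , e) ∷ os) (fsuc i))) ≡⟨ cong sum (tabulate-cong (α-term-suc v e os)) ⟩
    sum (tabulate (λ i → 2 ^ (v + e) * α-term os i))     ≡⟨ cong sum (map-tabulate (α-term os) (2 ^ (v + e) *_)) ⟨
    sum (map (2 ^ (v + e) *_) (tabulate (α-term os)))    ≡⟨ sum-scale (2 ^ (v + e)) (tabulate (α-term os)) ⟩
    2 ^ (v + e) * sum (tabulate (α-term os))             ≡⟨ cong (2 ^ (v + e) *_) (α-as-sum os) ⟨
    2 ^ (v + e) * α os                                   ∎

U-snoc : ∀ os u d → U (os ++ (u , d) ∷ []) ≡ U os + u
U-snoc []             u d = +-identityʳ u
U-snoc ((v , e) ∷ os) u d = trans (cong (λ n → v + n) (U-snoc os u d)) (sym (+-assoc v (U os) u))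

two-power-cons : ∀ v e os → 2 ^ (U ((v , e) ∷ os) + D ((v , e) ∷ os)) ≡ 2 ^ (v + e) * 2 ^ (U os + D os)
two-power-cons v e os = trans (cong (2 ^_) (interchange v e (U os) (D os))) (^-distribˡ-+-* 2 (v + e) (U os + D os))
  where
  interchange : ∀ a b c d → (a + c) + (b + d) ≡ (a + b) + (c + d)
  interchange = ℕ-Ring.solve-∀

α-snoc : ∀ os u d → α (os ++ (u , d) ∷ []) ≡ 3 ^ u * α os + γ u * 2 ^ (U os + D os)
α-snoc [] u d = trans (α-cons u d []) (unit (γ u) (2 ^ (u + d)) (3 ^ u))
  where
  unit : ∀ g p t → g * 1 + p * 0 ≡ t * 0 + g * 1
  unit = ℕ-Ring.solve-∀
α-snoc ((v , e) ∷ os) u d = begin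
  α ((v , e) ∷ (os ++ (u , d) ∷ []))
    ≡⟨ α-cons v e (os ++ (u , d) ∷ []) ⟩
  γ v * 3 ^ U (os ++ (u , d) ∷ []) + 2 ^ (v + e) * α (os ++ (u , d) ∷ [])
    ≡⟨ cong₂ (λ n z → γ v * 3 ^ n + 2 ^ (v + e) * z) (U-snoc os u d) (α-snoc os u d) ⟩
  γ v * 3 ^ (U os + u) + 2 ^ (v + e) * (3 ^ u * α os + γ u * 2 ^ (U os + D os))
    ≡⟨ cong (λ p → γ v * p + 2 ^ (v + e) * (3 ^ u * α os + γ u * 2 ^ (U os + D os))) (^-distribˡ-+-* 3 (U os) u) ⟩
  γ v * (3 ^ U os * 3 ^ u) + 2 ^ (v + e) * (3 ^ u * α os + γ u * 2 ^ (U os + D os))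
    ≡⟨ rearrange (γ v) (3 ^ U os) (3 ^ u) (2 ^ (v + e)) (α os) (2 ^ (U os + D os)) (γ u) ⟩
  3 ^ u * (γ v * 3 ^ U os + 2 ^ (v + e) * α os) + γ u * (2 ^ (v + e) * 2 ^ (U os + D os))
    ≡⟨ cong₂ (λ a p → 3 ^ u * a + γ u * p) (α-cons v e os) (two-power-cons v e os) ⟨
  3 ^ u * α ((v , e) ∷ os) + γ u * 2 ^ (U ((v , e) ∷ os) + D ((v , e) ∷ os))
    ∎
  where
  rearrange : ∀ g r t p a n h → g * (r * t) + p * (t * a + h * n) ≡ t * (g * r + p * a) + h * (p * n)
  rearrange = ℕ-Ring.solve-∀

-- (3) Shifting the cycle relation by one orb, over ℤ

-- If a T₁ = t T₀ + c k and T₀ β = k (c R₃ + a A) with β = a R₂ - t R₃,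
-- then T₁ β = k (t A + c R₂): multiply by a, substitute, cancel a ≠ 0.
cycle-shift : ∀ (a t c k T₀ T₁ R₂ R₃ A : ℤ) .{{_ : NonZero a}} →
  a *ℤ T₁ ≡ t *ℤ T₀ +ℤ c *ℤ k →
  T₀ *ℤ (a *ℤ R₂ - t *ℤ R₃) ≡ k *ℤ (c *ℤ R₃ +ℤ a *ℤ A) →
  T₁ *ℤ (a *ℤ R₂ - t *ℤ R₃) ≡ k *ℤ (t *ℤ A +ℤ c *ℤ R₂)
cycle-shift a t c k T₀ T₁ R₂ R₃ A step cycle = *-cancelˡ-≡ a _ _ (begin
  a *ℤ (T₁ *ℤ β)                      ≡⟨ reassoc a T₁ β ⟩
  (a *ℤ T₁) *ℤ β                      ≡⟨ cong (_*ℤ β) step ⟩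
  (t *ℤ T₀ +ℤ c *ℤ k) *ℤ β            ≡⟨ distribute t T₀ c k β ⟩
  t *ℤ (T₀ *ℤ β) +ℤ c *ℤ k *ℤ β       ≡⟨ cong (λ z → t *ℤ z +ℤ c *ℤ k *ℤ β) cycle ⟩
  t *ℤ (k *ℤ (c *ℤ R₃ +ℤ a *ℤ A)) +ℤ c *ℤ k *ℤ β ≡⟨ cancel-R₃ a t c k R₂ R₃ A ⟩
  a *ℤ (k *ℤ (t *ℤ A +ℤ c *ℤ R₂))     ∎)
  where
  β = a *ℤ R₂ - t *ℤ R₃
  reassoc : ∀ a x y → a *ℤ (x *ℤ y) ≡ (a *ℤ x) *ℤ y
  reassoc = ℤ-Ring.solve-∀
  distribute : ∀ t x c k y → (t *ℤ x +ℤ c *ℤ k) *ℤ y ≡ t *ℤ (x *ℤ y) +ℤ c *ℤ k *ℤ y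
  distribute = ℤ-Ring.solve-∀
  cancel-R₃ : ∀ a t c k R₂ R₃ A →
    t *ℤ (k *ℤ (c *ℤ R₃ +ℤ a *ℤ A)) +ℤ c *ℤ k *ℤ (a *ℤ R₂ - t *ℤ R₃) ≡ a *ℤ (k *ℤ (t *ℤ A +ℤ c *ℤ R₂))
  cancel-R₃ = ℤ-Ring.solve-∀

pos-+-* : ∀ p q r s → + (p * q + r * s) ≡ + p *ℤ + q +ℤ + r *ℤ + s
pos-+-* p q r s = trans (pos-+ (p * q) (r * s)) (cong₂ _+ℤ_ (pos-* p q) (pos-* r s))

pos-scaled : ∀ k {x} p q r s → x ≡ p * q + r * s → + (k * x) ≡ + k *ℤ (+ p *ℤ + q +ℤ + r *ℤ + s)
pos-scaled k {x} p q r s x≡ = trans (pos-* k x) (cong (λ z → + k *ℤ z) (trans (cong +_ x≡) (pos-+-* p q r s)))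

theorem9 : (k : ℕ) → k % 2 ≡ 1 →
    (u₁ d₁ : ℕ) → (rest : List (ℕ × ℕ)) →
    All (λ p → 1 ≤ proj₁ p × 1 ≤ proj₂ p) ((u₁ , d₁) ∷ rest) →
    (T₀ : ℕ) →
    (+ T₀) *ℤ (+ (2 ^ (U ((u₁ , d₁) ∷ rest) + D ((u₁ , d₁) ∷ rest))) - + (3 ^ U ((u₁ , d₁) ∷ rest)))
      ≡ + (k * α ((u₁ , d₁) ∷ rest)) →
    Follows k T₀ ((u₁ , d₁) ∷ rest) →
    iter (F k) (U ((u₁ , d₁) ∷ rest) + D ((u₁ , d₁) ∷ rest)) T₀ ≡ T₀ →
    (+ iter (F k) (u₁ + d₁) T₀) *ℤ (+ (2 ^ (U ((u₁ , d₁) ∷ rest) + D ((u₁ , d₁) ∷ rest))) - + (3 ^ U ((u₁ , d₁) ∷ rest)))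
      ≡ + (k * α (rest ++ (u₁ , d₁) ∷ []))
theorem9 k hk u d rest _ T₀ cycle follows _ = begin
  + T₁ *ℤ β                                         ≡⟨ cong (λ b → + T₁ *ℤ b) β-split ⟩
  + T₁ *ℤ (+ a *ℤ + R₂ - + t *ℤ + R₃)               ≡⟨ cycle-shift (+ a) (+ t) (+ γ u) (+ k) (+ T₀) (+ T₁) (+ R₂) (+ R₃) (+ A)
                                                         {{m^n≢0 2 (u + d)}} step cycle′ ⟩
  + k *ℤ (+ t *ℤ + A +ℤ + γ u *ℤ + R₂)              ≡⟨ pos-scaled k t A (γ u) R₂ (α-snoc rest u d) ⟨
  + (k * α (rest ++ (u , d) ∷ []))                  ∎
  where
  os = (u , d) ∷ rest
  a  = 2 ^ (u + d)
  t  = 3 ^ u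
  R₂ = 2 ^ (U rest + D rest)
  R₃ = 3 ^ U rest
  A  = α rest
  T₁ = iter (F k) (u + d) T₀
  β  = + (2 ^ (U os + D os)) - + (3 ^ U os)
  β-split : β ≡ + a *ℤ + R₂ - + t *ℤ + R₃
  β-split = cong₂ _-_ (trans (cong +_ (two-power-cons u d rest)) (pos-* a R₂))
                      (trans (cong +_ (^-distribˡ-+-* 3 u (U rest))) (pos-* t R₃))
  step : + a *ℤ + T₁ ≡ + t *ℤ + T₀ +ℤ + γ u *ℤ + k
  step = trans (sym (pos-* a T₁)) (trans (cong +_ (orb-step k hk u d T₀ (pattern' rest) follows)) (pos-+-* t T₀ (γ u) k))
  cycle′ : + T₀ *ℤ (+ a *ℤ + R₂ - + t *ℤ + R₃) ≡ + k *ℤ (+ γ u *ℤ + R₃ +ℤ + a *ℤ + A)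
  cycle′ = trans (cong (λ b → + T₀ *ℤ b) (sym β-split)) (trans cycle (pos-scaled k (γ u) R₃ a A (α-cons u d rest)))
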